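{- Let $A$ be a subset of $\mathbb{F}_q^2\times\mathbb{F}_q^2$ such that for every $(m_1,m_2)\in A$ with $m_1=(u_1,v_1)$, $m_2=(u_2,v_2)$ we have $u_1\neq 0$, $u_2\neq 0$ and $(v_1,v_2)\neq(0,0)$. Assume that the image of $A$ under the first projection $\mathbb{F}_q^2\times\mathbb{F}_q^2\to\mathbb{F}_q^2$ does not contain two distinct points on the same line through the origin. Let $f:\mathrm{SL}_2(\mathbb{F}_q)\to\mathbb{F}_q^3$ be the map $\begin{pmatrix} a& b\\ c& d\end{pmatrix}\mapsto (a,d,c)$. Then: (i) for every $(m_1,m_2)\in A$, the set $\ell_{m_1\to m_2}:=f(\{\theta\in\mathrm{SL}_2(\mathbb{F}_q):\theta m_1=m_2\})$ is a line in $\mathbb{F}_q^3$; (ii) for $(m_1,m_2)\neq(m_1',m_2')$ in $A$, we have $\ell_{m_1\to m_2}\neq\ell_{m_1'\to m_2'}$; (iii) $f$ is injective on the set $\mathrm{SL}_2(\mathbb{F}_q)\setminus\{\theta:\theta(e_1)=e_1\}$, where $e_1$ is the line $\{y=0\}$ in $\mathbb{F}_q^2$.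
   Context: Points of $\mathbb{F}_q^2$ are treated as column vectors, and $\mathrm{SL}_2(\mathbb{F}_q)$ acts by matrix multiplication; $\theta(e_1)=\{\theta x: x\in e_1\}$. -}

module Defs where

open import Level using (Level; _⊔_) renaming (suc to lsuc)
open import Algebra.Bundles using (CommutativeRing)
open import Data.Product using (Σ; ∃; _×_; _,_)
open import Data.List using (List)
open import Data.List.Relation.Unary.Any using (Any)
open import Relation.Nullary using (¬_)
open import Relation.Binary using (Decidable)

record FiniteField (c ℓ : Level) : Set (lsuc (c ⊔ ℓ)) where
  field
    commutativeRing : CommutativeRing c ℓ
  open CommutativeRing commutativeRing public
  field
    0≉1      : ¬ (0# ≈ 1#)
    inverse  : ∀ x → ¬ (x ≈ 0#) → ∃ λ y → x * y ≈ 1#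
    _≟_      : Decidable _≈_
    elements : List Carrier
    complete : ∀ x → Any (x ≈_) elements

module Geometry {c ℓ : Level} (F : FiniteField c ℓ) where
  open FiniteField F

  Pt2 : Set c
  Pt2 = Carrier × Carrier

  Pt3 : Set c
  Pt3 = Carrier × Carrier × Carrier

  _≈₂_ : Pt2 → Pt2 → Set ℓ
  (x , y) ≈₂ (x' , y') = (x ≈ x') × (y ≈ y')

  _≈₃_ : Pt3 → Pt3 → Set ℓ
  (x , y , z) ≈₃ (x' , y' , z') = (x ≈ x') × (y ≈ y') × (z ≈ z')

  0₃ : Pt3
  0₃ = (0# , 0# , 0#)

  _·₂_ : Carrier → Pt2 → Pt2
  t ·₂ (x , y) = (t * x , t * y)

  _·₃_ : Carrier → Pt3 → Pt3
  t ·₃ (x , y , z) = (t * x , t * y , t * z)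

  _+₃_ : Pt3 → Pt3 → Pt3
  (x , y , z) +₃ (x' , y' , z') = (x + x' , y + y' , z + z')

  record Mat : Set c where
    constructor mat
    field
      a b c' d : Carrier

  _≈M_ : Mat → Mat → Set ℓ
  mat a b c₁ d ≈M mat a' b' c₁' d' = (a ≈ a') × (b ≈ b') × (c₁ ≈ c₁') × (d ≈ d')

  det : Mat → Carrier
  det (mat a b c₁ d) = a * d - b * c₁

  IsSL2 : Mat → Set ℓ
  IsSL2 θ = det θ ≈ 1#

  act : Mat → Pt2 → Pt2
  act (mat a b c₁ d) (x , y) = (a * x + b * y , c₁ * x + d * y)

  f : Mat → Pt3
  f (mat a b c₁ d) = (a , d , c₁)

  SameSet : ∀ {a} {X : Set a} → (X → Set (c ⊔ ℓ)) → (X → Set (c ⊔ ℓ)) → Set (a ⊔ c ⊔ ℓ)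
  SameSet {X = X} S T = ∀ (x : X) → (S x → T x) × (T x → S x)

  IsLine : (Pt3 → Set (c ⊔ ℓ)) → Set (c ⊔ ℓ)
  IsLine L = Σ Pt3 λ p → Σ Pt3 λ w → ¬ (w ≈₃ 0₃) ×
             SameSet L (λ x → ∃ λ t → x ≈₃ (p +₃ (t ·₃ w)))

  lineTo : Pt2 → Pt2 → Pt3 → Set (c ⊔ ℓ)
  lineTo m₁ m₂ x = ∃ λ θ → IsSL2 θ × act θ m₁ ≈₂ m₂ × f θ ≈₃ x

  OnSameLineThroughOrigin : Pt2 → Pt2 → Set (c ⊔ ℓ)
  OnSameLineThroughOrigin p q = Σ Pt2 λ w → ¬ (w ≈₂ (0# , 0#)) ×
    (∃ λ s → p ≈₂ (s ·₂ w)) × (∃ λ t → q ≈₂ (t ·₂ w))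

  e₁ : Pt2 → Set (c ⊔ ℓ)
  e₁ (x , y) = Level.Lift c (y ≈ 0#)

  image : Mat → (Pt2 → Set (c ⊔ ℓ)) → Pt2 → Set (c ⊔ ℓ)
  image θ S y = ∃ λ x → S x × act θ x ≈₂ y

  FixesE₁ : Mat → Set (c ⊔ ℓ)
  FixesE₁ θ = SameSet (image θ e₁) e₁

  proj₁Img : (Pt2 × Pt2 → Set (c ⊔ ℓ)) → Pt2 → Set (c ⊔ ℓ)
  proj₁Img A m = ∃ λ m' → A (m , m')

{-# OPTIONS --safe #-}
module Submission where

-- For u₁, u₂ ≠ 0 the matrices θ ∈ SL₂ with θ m₁ = m₂ are parametrised by
-- their entry b: solving θ m₁ = m₂ and adj θ m₂ = m₁ expresses a, d and c as affine
-- functions of b, so ℓ_{m₁→m₂} is a line with direction (−v₁/u₁, v₂/u₂, −v₁v₂/(u₁u₂)),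
-- which is nonzero because (v₁, v₂) ≠ 0. An element of SL₂ with c ≠ 0 is determined by
-- (a, d, c) since bc = ad − 1, while c = 0 means that θ fixes e₁; this gives (iii).
-- For (ii), every point (a, d, c) of ℓ_{m₁→m₂} satisfies c u₁ + d v₁ = v₂. If it also
-- satisfies c x₁ + d y₁ = y₂, then d (u₁ y₁ − v₁ x₁) is constant along the line, which
-- forces m₁ and m₁' onto a common line through the origin, so m₁ = m₁' by the hypothesis
-- on A. Finally some point of ℓ_{m₁→m₂} has c ≠ 0, and the unique θ above it sends m₁
-- to both m₂ and m₂'.

open import Defs
open import Level using (Level; _⊔_; lift)
open import Algebra.Bundles using (CommutativeRing)
open import Algebra.Solver.Ring.AlmostCommutativeRing
  using (fromCommutativeRing; _-Raw-AlmostCommutative⟶_)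
open import Data.Integer.Base as ℤ using (ℤ; +_; -[1+_]; _⊖_; _◃_; sign; ∣_∣)
import Data.Integer.Properties as ℤ
open import Data.Maybe.Base using (Maybe; just; nothing)
open import Data.Nat.Base as ℕ using (zero; suc)
import Data.Nat.Properties as ℕ
open import Data.Product.Base using (_×_; _,_; proj₁; proj₂; ∃)
open import Data.Sign.Base as Sign using (Sign)
open import Data.Sum.Base using (_⊎_; inj₁; inj₂; [_,_]′)
open import Function.Base using (_∘_)
import Relation.Binary.PropositionalEquality.Core as ≡
open import Relation.Nullary.Decidable using (yes; no; _×-dec_; decidable-stable)
open import Relation.Nullary.Negation using (¬_; contradiction)
open import Relation.Unary using (_⊆_)

-- Solver coefficients are integers, interpreted through ℤ → R: coefficients taken from R
-- itself would not cancel definitionally, so normal forms could not be compared by refl.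
module IntegerCoefficients {c ℓ : Level} (R : CommutativeRing c ℓ) where
  open CommutativeRing R
  open import Algebra.Properties.Monoid.Mult.TCOptimised +-monoid
    using (×-homo-+; 1+×) renaming (_×_ to _×′_)
  open import Algebra.Properties.Semiring.Mult.TCOptimised semiring using (×1-homo-*)
  open import Algebra.Properties.Ring ring
    using (-‿distribˡ-*; -‿distribʳ-*; -‿involutive; -0#≈0#; -‿anti-homo-+)
  open import Relation.Binary.Reasoning.Setoid setoid

  fromℤ : ℤ → Carrier
  fromℤ (+ n)    = n ×′ 1#
  fromℤ -[1+ n ] = - (suc n ×′ 1#)

  private
    signed : Sign → Carrier → Carrier
    signed Sign.+ x = x
    signed Sign.- x = - x

    signed-cong : ∀ s {x y} → x ≈ y → signed s x ≈ signed s y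
    signed-cong Sign.+ x≈y = x≈y
    signed-cong Sign.- x≈y = -‿cong x≈y

    signed-* : ∀ s t x y → signed (s Sign.* t) (x * y) ≈ signed s x * signed t y
    signed-* Sign.+ Sign.+ x y = refl
    signed-* Sign.+ Sign.- x y = -‿distribʳ-* x y
    signed-* Sign.- Sign.+ x y = -‿distribˡ-* x y
    signed-* Sign.- Sign.- x y = begin
      x * y         ≈⟨ -‿involutive (x * y) ⟨
      - - (x * y)   ≈⟨ -‿cong (-‿distribˡ-* x y) ⟩
      - (- x * y)   ≈⟨ -‿distribʳ-* (- x) y ⟩
      - x * - y     ∎

    fromℤ-signAbs : ∀ i → fromℤ i ≈ signed (sign i) (∣ i ∣ ×′ 1#)
    fromℤ-signAbs (+ n)    = refl
    fromℤ-signAbs -[1+ n ] = refl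

    fromℤ-◃ : ∀ s n → fromℤ (s ◃ n) ≈ signed s (n ×′ 1#)
    fromℤ-◃ Sign.+ zero    = refl
    fromℤ-◃ Sign.- zero    = sym -0#≈0#
    fromℤ-◃ Sign.+ (suc n) = refl
    fromℤ-◃ Sign.- (suc n) = refl

    [1+x]-[1+y]≈x-y : ∀ x y → (1# + x) - (1# + y) ≈ x - y
    [1+x]-[1+y]≈x-y x y = begin
      (1# + x) + - (1# + y)   ≈⟨ +-congˡ (-‿anti-homo-+ 1# y) ⟩
      (1# + x) + (- y + - 1#) ≈⟨ +-congʳ (+-comm 1# x) ⟩
      (x + 1#) + (- y + - 1#) ≈⟨ +-assoc x 1# _ ⟩
      x + (1# + (- y + - 1#)) ≈⟨ +-congˡ (+-comm 1# _) ⟩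
      x + ((- y + - 1#) + 1#) ≈⟨ +-congˡ (+-assoc (- y) (- 1#) 1#) ⟩
      x + (- y + (- 1# + 1#)) ≈⟨ +-congˡ (+-congˡ (-‿inverseˡ 1#)) ⟩
      x + (- y + 0#)          ≈⟨ +-congˡ (+-identityʳ (- y)) ⟩
      x - y                   ∎

    fromℤ-⊖ : ∀ m n → fromℤ (m ⊖ n) ≈ m ×′ 1# - n ×′ 1#
    fromℤ-⊖ zero    zero    = sym (-‿inverseʳ 0#)
    fromℤ-⊖ zero    (suc n) = sym (+-identityˡ _)
    fromℤ-⊖ (suc m) zero    = sym (trans (+-congˡ -0#≈0#) (+-identityʳ _))
    fromℤ-⊖ (suc m) (suc n) = begin
      fromℤ (suc m ⊖ suc n)          ≡⟨ ≡.cong fromℤ (ℤ.[1+m]⊖[1+n]≡m⊖n m n) ⟩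
      fromℤ (m ⊖ n)                  ≈⟨ fromℤ-⊖ m n ⟩
      m ×′ 1# - n ×′ 1#                ≈⟨ [1+x]-[1+y]≈x-y _ _ ⟨
      (1# + m ×′ 1#) - (1# + n ×′ 1#)  ≈⟨ +-cong (1+× m 1#) (-‿cong (1+× n 1#)) ⟨
      suc m ×′ 1# - suc n ×′ 1#        ∎

    fromℤ-+ : ∀ i j → fromℤ (i ℤ.+ j) ≈ fromℤ i + fromℤ j
    fromℤ-+ (+ m)    (+ n)    = ×-homo-+ 1# m n
    fromℤ-+ (+ m)    -[1+ n ] = fromℤ-⊖ m (suc n)
    fromℤ-+ -[1+ m ] (+ n)    = trans (fromℤ-⊖ n (suc m)) (+-comm _ _)
    fromℤ-+ -[1+ m ] -[1+ n ] = begin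
      - (suc (suc (m ℕ.+ n)) ×′ 1#)   ≡⟨ ≡.cong (λ k → - (k ×′ 1#)) (ℕ.+-suc (suc m) n) ⟨
      - ((suc m ℕ.+ suc n) ×′ 1#)     ≈⟨ -‿cong (×-homo-+ 1# (suc m) (suc n)) ⟩
      - (suc m ×′ 1# + suc n ×′ 1#)    ≈⟨ -‿anti-homo-+ _ _ ⟩
      - (suc n ×′ 1#) + - (suc m ×′ 1#) ≈⟨ +-comm _ _ ⟩
      - (suc m ×′ 1#) + - (suc n ×′ 1#) ∎

    fromℤ-* : ∀ i j → fromℤ (i ℤ.* j) ≈ fromℤ i * fromℤ j
    fromℤ-* i j = begin
      fromℤ (s ◃ ∣ i ∣ ℕ.* ∣ j ∣)                  ≈⟨ fromℤ-◃ s (∣ i ∣ ℕ.* ∣ j ∣) ⟩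
      signed s ((∣ i ∣ ℕ.* ∣ j ∣) ×′ 1#)           ≈⟨ signed-cong s (×1-homo-* ∣ i ∣ ∣ j ∣) ⟩
      signed s ((∣ i ∣ ×′ 1#) * (∣ j ∣ ×′ 1#))     ≈⟨ signed-* (sign i) (sign j) _ _ ⟩
      signed (sign i) (∣ i ∣ ×′ 1#) * signed (sign j) (∣ j ∣ ×′ 1#)
        ≈⟨ *-cong (fromℤ-signAbs i) (fromℤ-signAbs j) ⟨
      fromℤ i * fromℤ j                           ∎
      where s = sign i Sign.* sign j

    fromℤ-neg : ∀ i → fromℤ (ℤ.- i) ≈ - fromℤ i
    fromℤ-neg (+ zero)    = sym -0#≈0#
    fromℤ-neg (+ suc n)   = refl
    fromℤ-neg -[1+ n ]    = sym (-‿involutive _)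

    fromℤ-homomorphism : ℤ.+-*-rawRing -Raw-AlmostCommutative⟶ fromCommutativeRing R
    fromℤ-homomorphism = record
      { ⟦_⟧    = fromℤ
      ; +-homo = fromℤ-+
      ; *-homo = fromℤ-*
      ; -‿homo = fromℤ-neg
      ; 0-homo = refl
      ; 1-homo = refl
      }

    fromℤ-≟ : ∀ i j → Maybe (fromℤ i ≈ fromℤ j)
    fromℤ-≟ i j with i ℤ.≟ j
    ... | yes ≡.refl = just refl
    ... | no _     = nothing

  open import Algebra.Solver.Ring
    ℤ.+-*-rawRing (fromCommutativeRing R) fromℤ-homomorphism fromℤ-≟ public

module _ {c ℓ : Level} (F : FiniteField c ℓ) where
  open FiniteField F
  open Geometry F
  open import Algebra.Properties.Ring ring using (x∙y⁻¹≈ε⇒x≈y; -‿injective; -0#≈0#; x[y-z]≈xy-xz)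
  open IntegerCoefficients commutativeRing using (solve; _:=_; _:+_; _:*_; _:-_; :-_; con)
  open import Relation.Binary.Reasoning.Setoid setoid

  :0 :1 : ∀ {n} → IntegerCoefficients.Polynomial commutativeRing n
  :0 = con (+ 0)
  :1 = con (+ 1)

  -- x ≈ y follows from hypotheses Lᵢ ≈ Rᵢ once the solver checks x - y ≈ Σ kᵢ * (Lᵢ - Rᵢ);
  -- the right-hand side is assembled from the hypotheses with _⊛_ and _⊕_.
  infixl 4 _⊕_
  infix  5 _⊛_

  _⊛_ : ∀ k {x y} → x ≈ y → k * (x - y) ≈ 0#
  k ⊛ x≈y = trans (*-congˡ (trans (+-congʳ x≈y) (-‿inverseʳ _))) (zeroʳ k)

  _⊕_ : ∀ {x y} → x ≈ 0# → y ≈ 0# → x + y ≈ 0#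
  x≈0 ⊕ y≈0 = trans (+-cong x≈0 y≈0) (+-identityʳ 0#)

  linear-combination : ∀ {x y z} → x - y ≈ z → z ≈ 0# → x ≈ y
  linear-combination x-y≈z z≈0 = x∙y⁻¹≈ε⇒x≈y _ _ (trans x-y≈z z≈0)

  x*y≈1⇒y≉0 : ∀ {x y} → x * y ≈ 1# → ¬ y ≈ 0#
  x*y≈1⇒y≉0 {x} xy≈1 y≈0 = 0≉1 (trans (sym (trans (*-congˡ y≈0) (zeroʳ x))) xy≈1)

  x*y≈0⇒y≈0 : ∀ {x y} → ¬ x ≈ 0# → x * y ≈ 0# → y ≈ 0#
  x*y≈0⇒y≈0 {x} {y} x≉0 xy≈0 with inverse x x≉0
  ... | x⁻¹ , xx⁻¹≈1 = linear-combination
    (solve 3 (λ x y x⁻¹ → y :- :0 := x⁻¹ :* (x :* y :- :0) :+ :- y :* (x :* x⁻¹ :- :1)) refl x y x⁻¹)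
    (x⁻¹ ⊛ xy≈0 ⊕ - y ⊛ xx⁻¹≈1)

  x*y≈0⇒x≈0 : ∀ {x y} → ¬ y ≈ 0# → x * y ≈ 0# → x ≈ 0#
  x*y≈0⇒x≈0 y≉0 xy≈0 = x*y≈0⇒y≈0 y≉0 (trans (*-comm _ _) xy≈0)

  x*y≉0 : ∀ {x y} → ¬ x ≈ 0# → ¬ y ≈ 0# → ¬ x * y ≈ 0#
  x*y≉0 x≉0 y≉0 = y≉0 ∘ x*y≈0⇒y≈0 x≉0

  x*y≈0⇒x≈0⊎y≈0 : ∀ {x y} → x * y ≈ 0# → x ≈ 0# ⊎ y ≈ 0#
  x*y≈0⇒x≈0⊎y≈0 {x} xy≈0 with x ≟ 0#
  ... | yes x≈0 = inj₁ x≈0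
  ... | no  x≉0 = inj₂ (x*y≈0⇒y≈0 x≉0 xy≈0)

  *-cancelˡ-≉0 : ∀ {x y z} → ¬ x ≈ 0# → x * y ≈ x * z → y ≈ z
  *-cancelˡ-≉0 {x} {y} {z} x≉0 xy≈xz = x∙y⁻¹≈ε⇒x≈y y z
    (x*y≈0⇒y≈0 x≉0 (trans (x[y-z]≈xy-xz x y z) (trans (+-congʳ xy≈xz) (-‿inverseʳ _))))

  ≈₂-sym : ∀ {m m'} → m ≈₂ m' → m' ≈₂ m
  ≈₂-sym {_ , _} {_ , _} (x≈ , y≈) = sym x≈ , sym y≈

  ≈₂-trans : ∀ {m m' m''} → m ≈₂ m' → m' ≈₂ m'' → m ≈₂ m''
  ≈₂-trans {_ , _} {_ , _} {_ , _} (x≈ , y≈) (x≈' , y≈') = trans x≈ x≈' , trans y≈ y≈'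

  ≈₃-sym : ∀ {p q} → p ≈₃ q → q ≈₃ p
  ≈₃-sym {_ , _ , _} {_ , _ , _} (x≈ , y≈ , z≈) = sym x≈ , sym y≈ , sym z≈

  ≈₃-trans : ∀ {p q r} → p ≈₃ q → q ≈₃ r → p ≈₃ r
  ≈₃-trans {_ , _ , _} {_ , _ , _} {_ , _ , _} (x≈ , y≈ , z≈) (x≈' , y≈' , z≈') =
    trans x≈ x≈' , trans y≈ y≈' , trans z≈ z≈'

  f-cong : ∀ {θ θ'} → θ ≈M θ' → f θ ≈₃ f θ'
  f-cong {mat _ _ _ _} {mat _ _ _ _} (a≈ , _ , c≈ , d≈) = a≈ , d≈ , c≈

  act-cong : ∀ {θ θ' m m'} → θ ≈M θ' → m ≈₂ m' → act θ m ≈₂ act θ' m'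
  act-cong {mat _ _ _ _} {mat _ _ _ _} {_ , _} {_ , _} (a≈ , b≈ , c≈ , d≈) (x≈ , y≈) =
    +-cong (*-cong a≈ x≈) (*-cong b≈ y≈) , +-cong (*-cong c≈ x≈) (*-cong d≈ y≈)

  adjugate : Mat → Mat
  adjugate (mat a b c d) = mat d (- b) (- c) a

  adjugate-inverts : ∀ {θ m m'} → IsSL2 θ → act θ m ≈₂ m' → act (adjugate θ) m' ≈₂ m
  adjugate-inverts {mat a b c d} {x , y} {x' , y'} det≈1 (row₁ , row₂) =
      linear-combination
        (solve 8 (λ a b c d x y x' y' →
           d :* x' :+ :- b :* y' :- x
             := :- d :* (a :* x :+ b :* y :- x') :+ b :* (c :* x :+ d :* y :- y')
                :+ x :* (a :* d :- b :* c :- :1))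
           refl a b c d x y x' y')
        (- d ⊛ row₁ ⊕ b ⊛ row₂ ⊕ x ⊛ det≈1)
    , linear-combination
        (solve 8 (λ a b c d x y x' y' →
           :- c :* x' :+ a :* y' :- y
             := c :* (a :* x :+ b :* y :- x') :+ :- a :* (c :* x :+ d :* y :- y')
                :+ y :* (a :* d :- b :* c :- :1))
           refl a b c d x y x' y')
        (c ⊛ row₁ ⊕ - a ⊛ row₂ ⊕ y ⊛ det≈1)

  IsSL2⇒c*b≈a*d-1 : ∀ {a b c d} → IsSL2 (mat a b c d) → c * b ≈ a * d - 1#
  IsSL2⇒c*b≈a*d-1 {a} {b} {c} {d} det≈1 = linear-combination
    (solve 4 (λ a b c d → c :* b :- (a :* d :- :1) := :- :1 :* (a :* d :- b :* c :- :1)) refl a b c d)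
    (- 1# ⊛ det≈1)

  SL₂-determined-by-f : ∀ {θ θ'} → IsSL2 θ → IsSL2 θ' → ¬ Mat.c' θ ≈ 0# → f θ ≈₃ f θ' → θ ≈M θ'
  SL₂-determined-by-f {mat a b c d} {mat a' b' c' d'} det≈1 det'≈1 c≉0 (a≈a' , d≈d' , c≈c') =
    a≈a' , *-cancelˡ-≉0 c≉0 cb≈cb' , c≈c' , d≈d'
    where
    cb≈cb' : c * b ≈ c * b'
    cb≈cb' = begin
      c * b         ≈⟨ IsSL2⇒c*b≈a*d-1 det≈1 ⟩
      a * d - 1#    ≈⟨ +-congʳ (*-cong a≈a' d≈d') ⟩
      a' * d' - 1#  ≈⟨ IsSL2⇒c*b≈a*d-1 det'≈1 ⟨
      c' * b'       ≈⟨ *-congʳ c≈c' ⟨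
      c * b'        ∎

  c≈0⇒FixesE₁ : ∀ {θ} → IsSL2 θ → Mat.c' θ ≈ 0# → FixesE₁ θ
  c≈0⇒FixesE₁ {mat a b c d} det≈1 c≈0 (x , y) = image⊆e₁ , e₁⊆image
    where
    image⊆e₁ : image (mat a b c d) e₁ (x , y) → e₁ (x , y)
    image⊆e₁ ((x' , y') , lift y'≈0 , (_ , row₂)) = lift (begin
      y                 ≈⟨ row₂ ⟨
      c * x' + d * y'   ≈⟨ +-cong (*-congʳ c≈0) (*-congˡ y'≈0) ⟩
      0# * x' + d * 0#  ≈⟨ +-cong (zeroˡ x') (zeroʳ d) ⟩
      0# + 0#           ≈⟨ +-identityʳ 0# ⟩
      0#                ∎)

    e₁⊆image : e₁ (x , y) → image (mat a b c d) e₁ (x , y)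
    e₁⊆image (lift y≈0) = (d * x , 0#) , lift refl , row₁ , row₂
      where
      row₁ : a * (d * x) + b * 0# ≈ x
      row₁ = linear-combination
        (solve 5 (λ a b c d x →
           a :* (d :* x) :+ b :* :0 :- x := x :* (a :* d :- b :* c :- :1) :+ b :* x :* (c :- :0))
           refl a b c d x)
        (x ⊛ det≈1 ⊕ b * x ⊛ c≈0)
      row₂ : c * (d * x) + d * 0# ≈ y
      row₂ = linear-combination
        (solve 4 (λ c d x y →
           c :* (d :* x) :+ d :* :0 :- y := d :* x :* (c :- :0) :+ :- :1 :* (y :- :0))
           refl c d x y)
        (d * x ⊛ c≈0 ⊕ - 1# ⊛ y≈0)

  f-injective : ∀ {θ θ'} → IsSL2 θ → IsSL2 θ' → ¬ FixesE₁ θ → f θ ≈₃ f θ' → θ ≈M θ'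
  f-injective det≈1 det'≈1 θ-moves-e₁ =
    SL₂-determined-by-f det≈1 det'≈1 (θ-moves-e₁ ∘ c≈0⇒FixesE₁ det≈1)

  lineTo⇒second-row : ∀ {x y x' y' a d c} → lineTo (x , y) (x' , y') (a , d , c) → c * x + d * y ≈ y'
  lineTo⇒second-row (mat _ _ _ _ , _ , (_ , row₂) , (_ , d'≈d , c'≈c)) =
    trans (+-cong (*-congʳ (sym c'≈c)) (*-congʳ (sym d'≈d))) row₂

  collinear⇒onSameLineThroughOrigin : ∀ {u v x y} → ¬ u ≈ 0# → u * y ≈ v * x →
                                      OnSameLineThroughOrigin (u , v) (x , y)
  collinear⇒onSameLineThroughOrigin {u} {v} {x} {y} u≉0 uy≈vx with inverse u u≉0
  ... | u⁻¹ , uu⁻¹≈1 =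
    (u , v) , u≉0 ∘ proj₁ , (1# , sym (*-identityˡ u) , sym (*-identityˡ v)) , (x * u⁻¹ , x≈ , y≈)
    where
    x≈ : x ≈ x * u⁻¹ * u
    x≈ = linear-combination
      (solve 3 (λ x u u⁻¹ → x :- x :* u⁻¹ :* u := :- x :* (u :* u⁻¹ :- :1)) refl x u u⁻¹)
      (- x ⊛ uu⁻¹≈1)
    y≈ : y ≈ x * u⁻¹ * v
    y≈ = linear-combination
      (solve 5 (λ u v x y u⁻¹ →
         y :- x :* u⁻¹ :* v := u⁻¹ :* (u :* y :- v :* x) :+ :- y :* (u :* u⁻¹ :- :1))
         refl u v x y u⁻¹)
      (u⁻¹ ⊛ uy≈vx ⊕ - y ⊛ uu⁻¹≈1)

  module Transporters (u₁ v₁ u₂ v₂ : Carrier) (u₁≉0 : ¬ u₁ ≈ 0#) (u₂≉0 : ¬ u₂ ≈ 0#) where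

    u₁⁻¹ u₂⁻¹ : Carrier
    u₁⁻¹ = proj₁ (inverse u₁ u₁≉0)
    u₂⁻¹ = proj₁ (inverse u₂ u₂≉0)

    u₁u₁⁻¹≈1 : u₁ * u₁⁻¹ ≈ 1#
    u₁u₁⁻¹≈1 = proj₂ (inverse u₁ u₁≉0)

    u₂u₂⁻¹≈1 : u₂ * u₂⁻¹ ≈ 1#
    u₂u₂⁻¹≈1 = proj₂ (inverse u₂ u₂≉0)

    a₀ d₀ c₀ ∂a ∂d ∂c : Carrier
    a₀ = u₂ * u₁⁻¹
    d₀ = u₁ * u₂⁻¹
    c₀ = v₂ * u₁⁻¹ - v₁ * u₂⁻¹
    ∂a = - (v₁ * u₁⁻¹)
    ∂d = v₂ * u₂⁻¹
    ∂c = - (v₁ * v₂ * u₁⁻¹ * u₂⁻¹)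

    a[_] d[_] c[_] : Carrier → Carrier
    a[ t ] = a₀ + t * ∂a
    d[ t ] = d₀ + t * ∂d
    c[ t ] = c₀ + t * ∂c

    transporter : Carrier → Mat
    transporter t = mat a[ t ] t c[ t ] d[ t ]

    transporter-isSL2 : ∀ t → IsSL2 (transporter t)
    transporter-isSL2 t = linear-combination
      (solve 7 (λ u₁ v₁ u₂ v₂ u₁⁻¹ u₂⁻¹ t →
         (u₂ :* u₁⁻¹ :+ t :* :- (v₁ :* u₁⁻¹)) :* (u₁ :* u₂⁻¹ :+ t :* (v₂ :* u₂⁻¹))
           :- t :* (v₂ :* u₁⁻¹ :- v₁ :* u₂⁻¹ :+ t :* :- (v₁ :* v₂ :* u₁⁻¹ :* u₂⁻¹)) :- :1
         := (u₂ :* u₂⁻¹ :- t :* v₁ :* u₂⁻¹) :* (u₁ :* u₁⁻¹ :- :1)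
            :+ (:1 :+ t :* v₂ :* u₁⁻¹) :* (u₂ :* u₂⁻¹ :- :1))
         refl u₁ v₁ u₂ v₂ u₁⁻¹ u₂⁻¹ t)
      (u₂ * u₂⁻¹ - t * v₁ * u₂⁻¹ ⊛ u₁u₁⁻¹≈1 ⊕ 1# + t * v₂ * u₁⁻¹ ⊛ u₂u₂⁻¹≈1)

    transporter-transports : ∀ t → act (transporter t) (u₁ , v₁) ≈₂ (u₂ , v₂)
    transporter-transports t =
        linear-combination
          (solve 5 (λ u₁ v₁ u₂ u₁⁻¹ t →
             (u₂ :* u₁⁻¹ :+ t :* :- (v₁ :* u₁⁻¹)) :* u₁ :+ t :* v₁ :- u₂
             := (u₂ :- t :* v₁) :* (u₁ :* u₁⁻¹ :- :1))
             refl u₁ v₁ u₂ u₁⁻¹ t)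
          (u₂ - t * v₁ ⊛ u₁u₁⁻¹≈1)
      , linear-combination
          (solve 7 (λ u₁ v₁ u₂ v₂ u₁⁻¹ u₂⁻¹ t →
             (v₂ :* u₁⁻¹ :- v₁ :* u₂⁻¹ :+ t :* :- (v₁ :* v₂ :* u₁⁻¹ :* u₂⁻¹)) :* u₁
               :+ (u₁ :* u₂⁻¹ :+ t :* (v₂ :* u₂⁻¹)) :* v₁ :- v₂
             := (v₂ :- t :* v₁ :* v₂ :* u₂⁻¹) :* (u₁ :* u₁⁻¹ :- :1))
             refl u₁ v₁ u₂ v₂ u₁⁻¹ u₂⁻¹ t)
          (v₂ - t * v₁ * v₂ * u₂⁻¹ ⊛ u₁u₁⁻¹≈1)

    transporter-onLine : ∀ t → lineTo (u₁ , v₁) (u₂ , v₂) (f (transporter t))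
    transporter-onLine t = transporter t , transporter-isSL2 t , transporter-transports t , (refl , refl , refl)

    transports⇒≈transporter : ∀ {θ} → IsSL2 θ → act θ (u₁ , v₁) ≈₂ (u₂ , v₂) → θ ≈M transporter (Mat.b θ)
    transports⇒≈transporter {mat a b c d} det≈1 θm₁≈m₂ = a≈a[b] , refl , c≈c[b] , d≈d[b]
      where
      row₁ : a * u₁ + b * v₁ ≈ u₂
      row₁ = proj₁ θm₁≈m₂
      back₁ : d * u₂ + - b * v₂ ≈ u₁
      back₁ = proj₁ (adjugate-inverts {mat a b c d} det≈1 θm₁≈m₂)
      back₂ : - c * u₂ + a * v₂ ≈ v₁
      back₂ = proj₂ (adjugate-inverts {mat a b c d} det≈1 θm₁≈m₂)
      a≈a[b] : a ≈ a[ b ]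
      a≈a[b] = linear-combination
        (solve 6 (λ a b u₁ v₁ u₂ u₁⁻¹ →
           a :- (u₂ :* u₁⁻¹ :+ b :* :- (v₁ :* u₁⁻¹))
           := u₁⁻¹ :* (a :* u₁ :+ b :* v₁ :- u₂) :+ :- a :* (u₁ :* u₁⁻¹ :- :1))
           refl a b u₁ v₁ u₂ u₁⁻¹)
        (u₁⁻¹ ⊛ row₁ ⊕ - a ⊛ u₁u₁⁻¹≈1)
      d≈d[b] : d ≈ d[ b ]
      d≈d[b] = linear-combination
        (solve 6 (λ b d u₁ u₂ v₂ u₂⁻¹ →
           d :- (u₁ :* u₂⁻¹ :+ b :* (v₂ :* u₂⁻¹))
           := u₂⁻¹ :* (d :* u₂ :+ :- b :* v₂ :- u₁) :+ :- d :* (u₂ :* u₂⁻¹ :- :1))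
           refl b d u₁ u₂ v₂ u₂⁻¹)
        (u₂⁻¹ ⊛ back₁ ⊕ - d ⊛ u₂u₂⁻¹≈1)
      c≈c[b] : c ≈ c[ b ]
      c≈c[b] = linear-combination
        (solve 9 (λ a b c u₁ v₁ u₂ v₂ u₁⁻¹ u₂⁻¹ →
           c :- (v₂ :* u₁⁻¹ :- v₁ :* u₂⁻¹ :+ b :* :- (v₁ :* v₂ :* u₁⁻¹ :* u₂⁻¹))
           := :- u₂⁻¹ :* (:- c :* u₂ :+ a :* v₂ :- v₁)
              :+ u₂⁻¹ :* v₂ :* (a :- (u₂ :* u₁⁻¹ :+ b :* :- (v₁ :* u₁⁻¹)))
              :+ (v₂ :* u₁⁻¹ :- c) :* (u₂ :* u₂⁻¹ :- :1))
           refl a b c u₁ v₁ u₂ v₂ u₁⁻¹ u₂⁻¹)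
        (- u₂⁻¹ ⊛ back₂ ⊕ u₂⁻¹ * v₂ ⊛ a≈a[b] ⊕ v₂ * u₁⁻¹ - c ⊛ u₂u₂⁻¹≈1)

    lineTo-isLine : ¬ (v₁ ≈ 0# × v₂ ≈ 0#) → IsLine (lineTo (u₁ , v₁) (u₂ , v₂))
    lineTo-isLine v≉0 = (a₀ , d₀ , c₀) , (∂a , ∂d , ∂c) , direction≉0 , onLine⇔onTransporterLine
      where
      direction≉0 : ¬ (∂a , ∂d , ∂c) ≈₃ 0₃
      direction≉0 (∂a≈0 , ∂d≈0 , _) = v≉0
        ( x*y≈0⇒x≈0 (x*y≈1⇒y≉0 u₁u₁⁻¹≈1) (-‿injective (trans ∂a≈0 (sym -0#≈0#)))
        , x*y≈0⇒x≈0 (x*y≈1⇒y≉0 u₂u₂⁻¹≈1) ∂d≈0 )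

      onLine⇔onTransporterLine : SameSet (lineTo (u₁ , v₁) (u₂ , v₂))
        (λ p → ∃ λ t → p ≈₃ ((a₀ , d₀ , c₀) +₃ (t ·₃ (∂a , ∂d , ∂c))))
      onLine⇔onTransporterLine p =
          (λ { (θ , det≈1 , θm₁≈m₂ , fθ≈p) →
                 Mat.b θ , ≈₃-trans (≈₃-sym fθ≈p) (f-cong (transports⇒≈transporter det≈1 θm₁≈m₂)) })
        , (λ { (t , p≈) → transporter t , transporter-isSL2 t , transporter-transports t , ≈₃-sym p≈ })

    c[0]≈0⇒c[1]≈0⇒v≈0 : c[ 0# ] ≈ 0# → c[ 1# ] ≈ 0# → v₁ ≈ 0# × v₂ ≈ 0#
    c[0]≈0⇒c[1]≈0⇒v≈0 c[0]≈0 c[1]≈0 =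
      [ (λ v₁≈0 → v₁≈0 , x*y≈0⇒x≈0 u₂≉0 (trans v₂u₂≈v₁u₁ (trans (*-congʳ v₁≈0) (zeroˡ u₁))))
      , (λ v₂≈0 → x*y≈0⇒x≈0 u₁≉0 (trans (sym v₂u₂≈v₁u₁) (trans (*-congʳ v₂≈0) (zeroˡ u₂))) , v₂≈0)
      ]′ (x*y≈0⇒x≈0⊎y≈0 v₁v₂≈0)
      where
      v₂u₂≈v₁u₁ : v₂ * u₂ ≈ v₁ * u₁
      v₂u₂≈v₁u₁ = linear-combination
        (solve 6 (λ u₁ v₁ u₂ v₂ u₁⁻¹ u₂⁻¹ →
           v₂ :* u₂ :- v₁ :* u₁
           := u₁ :* u₂ :* (v₂ :* u₁⁻¹ :- v₁ :* u₂⁻¹ :+ :0 :* :- (v₁ :* v₂ :* u₁⁻¹ :* u₂⁻¹) :- :0)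
              :+ :- (v₂ :* u₂) :* (u₁ :* u₁⁻¹ :- :1) :+ v₁ :* u₁ :* (u₂ :* u₂⁻¹ :- :1))
           refl u₁ v₁ u₂ v₂ u₁⁻¹ u₂⁻¹)
        (u₁ * u₂ ⊛ c[0]≈0 ⊕ - (v₂ * u₂) ⊛ u₁u₁⁻¹≈1 ⊕ v₁ * u₁ ⊛ u₂u₂⁻¹≈1)
      v₁v₂≈0 : v₁ * v₂ ≈ 0#
      v₁v₂≈0 = linear-combination
        (solve 6 (λ u₁ v₁ u₂ v₂ u₁⁻¹ u₂⁻¹ →
           v₁ :* v₂ :- :0
           := u₁ :* u₂ :* (v₂ :* u₁⁻¹ :- v₁ :* u₂⁻¹ :+ :0 :* :- (v₁ :* v₂ :* u₁⁻¹ :* u₂⁻¹) :- :0)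
              :+ :- (u₁ :* u₂) :* (v₂ :* u₁⁻¹ :- v₁ :* u₂⁻¹ :+ :1 :* :- (v₁ :* v₂ :* u₁⁻¹ :* u₂⁻¹) :- :0)
              :+ :- (v₁ :* v₂ :* u₂ :* u₂⁻¹) :* (u₁ :* u₁⁻¹ :- :1) :+ :- (v₁ :* v₂) :* (u₂ :* u₂⁻¹ :- :1))
           refl u₁ v₁ u₂ v₂ u₁⁻¹ u₂⁻¹)
        (u₁ * u₂ ⊛ c[0]≈0 ⊕ - (u₁ * u₂) ⊛ c[1]≈0
          ⊕ - (v₁ * v₂ * u₂ * u₂⁻¹) ⊛ u₁u₁⁻¹≈1 ⊕ - (v₁ * v₂) ⊛ u₂u₂⁻¹≈1)

    transporter-c≉0 : ¬ (v₁ ≈ 0# × v₂ ≈ 0#) → ∃ λ t → ¬ c[ t ] ≈ 0#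
    transporter-c≉0 v≉0 with c[ 0# ] ≟ 0#
    ... | no  c[0]≉0 = 0# , c[0]≉0
    ... | yes c[0]≈0 = 1# , v≉0 ∘ c[0]≈0⇒c[1]≈0⇒v≈0 c[0]≈0

    ⊆⇒collinear : ∀ {x₁ y₁ x₂ y₂} → lineTo (u₁ , v₁) (u₂ , v₂) ⊆ lineTo (x₁ , y₁) (x₂ , y₂) →
                  (v₂ ≈ 0# → y₂ ≈ 0#) → u₁ * y₁ ≈ v₁ * x₁
    ⊆⇒collinear {x₁} {y₁} {x₂} {y₂} ℓ⊆ℓ' v₂≈0⇒y₂≈0 = x∙y⁻¹≈ε⇒x≈y _ _ D≈0
      where
      d[t]D≈ : ∀ t → d[ t ] * (u₁ * y₁ - v₁ * x₁) ≈ u₁ * y₂ - v₂ * x₁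
      d[t]D≈ t = linear-combination
        (solve 8 (λ c d u₁ v₁ v₂ x₁ y₁ y₂ →
           d :* (u₁ :* y₁ :- v₁ :* x₁) :- (u₁ :* y₂ :- v₂ :* x₁)
           := u₁ :* (c :* x₁ :+ d :* y₁ :- y₂) :+ :- x₁ :* (c :* u₁ :+ d :* v₁ :- v₂))
           refl c[ t ] d[ t ] u₁ v₁ v₂ x₁ y₁ y₂)
        (u₁ ⊛ lineTo⇒second-row (ℓ⊆ℓ' (transporter-onLine t)) ⊕ - x₁ ⊛ proj₂ (transporter-transports t))

      D≈0 : u₁ * y₁ - v₁ * x₁ ≈ 0#
      D≈0 with v₂ ≟ 0#
      ... | no v₂≉0 = x*y≈0⇒y≈0 (x*y≉0 v₂≉0 (x*y≈1⇒y≉0 u₂u₂⁻¹≈1)) (linear-combination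
        (solve 5 (λ u₁ v₂ u₂⁻¹ D R →
           v₂ :* u₂⁻¹ :* D :- :0
           := :1 :* ((u₁ :* u₂⁻¹ :+ :1 :* (v₂ :* u₂⁻¹)) :* D :- R)
              :+ :- :1 :* ((u₁ :* u₂⁻¹ :+ :0 :* (v₂ :* u₂⁻¹)) :* D :- R))
           refl u₁ v₂ u₂⁻¹ (u₁ * y₁ - v₁ * x₁) (u₁ * y₂ - v₂ * x₁))
        (1# ⊛ d[t]D≈ 1# ⊕ - 1# ⊛ d[t]D≈ 0#))
      ... | yes v₂≈0 = x*y≈0⇒y≈0 (x*y≉0 u₁≉0 (x*y≈1⇒y≉0 u₂u₂⁻¹≈1)) (linear-combination
        (solve 6 (λ u₁ v₂ u₂⁻¹ D x₁ y₂ →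
           u₁ :* u₂⁻¹ :* D :- :0
           := :1 :* ((u₁ :* u₂⁻¹ :+ :0 :* (v₂ :* u₂⁻¹)) :* D :- (u₁ :* y₂ :- v₂ :* x₁))
              :+ u₁ :* (y₂ :- :0) :+ :- x₁ :* (v₂ :- :0))
           refl u₁ v₂ u₂⁻¹ (u₁ * y₁ - v₁ * x₁) x₁ y₂)
        (1# ⊛ d[t]D≈ 0# ⊕ u₁ ⊛ v₂≈0⇒y₂≈0 v₂≈0 ⊕ - x₁ ⊛ v₂≈0))

    ⊆⇒same-target : ¬ (v₁ ≈ 0# × v₂ ≈ 0#) → ∀ {m₁' m₂'} → (u₁ , v₁) ≈₂ m₁' →
                    lineTo (u₁ , v₁) (u₂ , v₂) ⊆ lineTo m₁' m₂' → (u₂ , v₂) ≈₂ m₂'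
    ⊆⇒same-target v≉0 {m₁'} {m₂'} m₁≈m₁' ℓ⊆ℓ' = via (transporter-c≉0 v≉0)
      where
      via : (∃ λ t → ¬ c[ t ] ≈ 0#) → (u₂ , v₂) ≈₂ m₂'
      via (t , c[t]≉0) = through (ℓ⊆ℓ' (transporter-onLine t))
        where
        through : lineTo m₁' m₂' (f (transporter t)) → (u₂ , v₂) ≈₂ m₂'
        through (θ , det≈1 , θm₁'≈m₂' , fθ≈) =
          ≈₂-trans (≈₂-sym (transporter-transports t)) (≈₂-trans (act-cong transporter≈θ m₁≈m₁') θm₁'≈m₂')
          where
          transporter≈θ : transporter t ≈M θ
          transporter≈θ = SL₂-determined-by-f (transporter-isSL2 t) det≈1 c[t]≉0 (≈₃-sym fθ≈)

  lineTo-injective : ∀ {u₁ v₁ u₂ v₂ x₁ y₁ x₂ y₂} →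
    ¬ u₁ ≈ 0# → ¬ u₂ ≈ 0# → ¬ (v₁ ≈ 0# × v₂ ≈ 0#) → ¬ x₁ ≈ 0# → ¬ x₂ ≈ 0# →
    (¬ (u₁ , v₁) ≈₂ (x₁ , y₁) → ¬ OnSameLineThroughOrigin (u₁ , v₁) (x₁ , y₁)) →
    SameSet (lineTo (u₁ , v₁) (u₂ , v₂)) (lineTo (x₁ , y₁) (x₂ , y₂)) →
    (u₁ , v₁) ≈₂ (x₁ , y₁) × (u₂ , v₂) ≈₂ (x₂ , y₂)
  lineTo-injective {u₁} {v₁} {u₂} {v₂} {x₁} {y₁} {x₂} {y₂} u₁≉0 u₂≉0 v≉0 x₁≉0 x₂≉0 separated ℓ≐ℓ' =
    m₁≈m₁' , Transporters.⊆⇒same-target u₁ v₁ u₂ v₂ u₁≉0 u₂≉0 v≉0 m₁≈m₁' ℓ⊆ℓ'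
    where
    ℓ⊆ℓ' : lineTo (u₁ , v₁) (u₂ , v₂) ⊆ lineTo (x₁ , y₁) (x₂ , y₂)
    ℓ⊆ℓ' = proj₁ (ℓ≐ℓ' _)

    ℓ'⊆ℓ : lineTo (x₁ , y₁) (x₂ , y₂) ⊆ lineTo (u₁ , v₁) (u₂ , v₂)
    ℓ'⊆ℓ = proj₂ (ℓ≐ℓ' _)

    collinear : u₁ * y₁ ≈ v₁ * x₁
    collinear with y₂ ≟ 0#
    ... | yes y₂≈0 = Transporters.⊆⇒collinear u₁ v₁ u₂ v₂ u₁≉0 u₂≉0 ℓ⊆ℓ' (λ _ → y₂≈0)
    ... | no  y₂≉0 = begin
      u₁ * y₁  ≈⟨ *-comm u₁ y₁ ⟩
      y₁ * u₁  ≈⟨ Transporters.⊆⇒collinear x₁ y₁ x₂ y₂ x₁≉0 x₂≉0 ℓ'⊆ℓ (λ y₂≈0 → contradiction y₂≈0 y₂≉0) ⟨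
      x₁ * v₁  ≈⟨ *-comm x₁ v₁ ⟩
      v₁ * x₁  ∎

    m₁≈m₁' : (u₁ , v₁) ≈₂ (x₁ , y₁)
    m₁≈m₁' = decidable-stable (u₁ ≟ x₁ ×-dec v₁ ≟ y₁)
      (λ m₁≉m₁' → separated m₁≉m₁' (collinear⇒onSameLineThroughOrigin u₁≉0 collinear))

lemma2p2 : ∀ {c ℓ : Level} (F : FiniteField c ℓ) →
  let open FiniteField F
      open Geometry F
  in (A : Pt2 × Pt2 → Set (c ⊔ ℓ)) →
     (∀ u₁ v₁ u₂ v₂ → A ((u₁ , v₁) , (u₂ , v₂)) →
        ¬ (u₁ ≈ 0#) × ¬ (u₂ ≈ 0#) × ¬ ((v₁ ≈ 0#) × (v₂ ≈ 0#))) →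
     (∀ m m' → proj₁Img A m → proj₁Img A m' → ¬ (m ≈₂ m') →
        ¬ OnSameLineThroughOrigin m m') →
     (∀ m₁ m₂ → A (m₁ , m₂) → IsLine (lineTo m₁ m₂))
     × (∀ m₁ m₂ m₁' m₂' → A (m₁ , m₂) → A (m₁' , m₂') →
          ¬ ((m₁ ≈₂ m₁') × (m₂ ≈₂ m₂')) →
          ¬ SameSet (lineTo m₁ m₂) (lineTo m₁' m₂'))
     × (∀ θ θ' → IsSL2 θ → IsSL2 θ' → ¬ FixesE₁ θ → ¬ FixesE₁ θ' →
          f θ ≈₃ f θ' → θ ≈M θ')
lemma2p2 F A nondegenerate separated =
    (λ { (u₁ , v₁) (u₂ , v₂) m∈A →
         let u₁≉0 , u₂≉0 , v≉0 = nondegenerate u₁ v₁ u₂ v₂ m∈A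
         in Transporters.lineTo-isLine F u₁ v₁ u₂ v₂ u₁≉0 u₂≉0 v≉0 })
  , (λ { (u₁ , v₁) (u₂ , v₂) (x₁ , y₁) (x₂ , y₂) m∈A m'∈A m≉m' ℓ≐ℓ' →
         let u₁≉0 , u₂≉0 , v≉0 = nondegenerate u₁ v₁ u₂ v₂ m∈A
             x₁≉0 , x₂≉0 , _   = nondegenerate x₁ y₁ x₂ y₂ m'∈A
         in m≉m' (lineTo-injective F u₁≉0 u₂≉0 v≉0 x₁≉0 x₂≉0
                    (separated (u₁ , v₁) (x₁ , y₁) (_ , m∈A) (_ , m'∈A)) ℓ≐ℓ') })
  , λ _ _ det≈1 det'≈1 θ-moves-e₁ _ → f-injective F det≈1 det'≈1 θ-moves-e₁
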